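{- There exists an infinite family of graphs $G_1,G_2,\dots$ such that $A_b(G_n)-A(G_n)\to\infty$ as $n\to\infty$.
   Context: A (proper) $k$-coloring of $G$ is a map $c:V(G)\to[k]$ with adjacent vertices colored differently, all $k$ colors used; $V_i=c^{ -1}(i)$. A coloring is acyclic if $G[V_i\cup V_j]$ is a forest for all $i,j$. The acyclic chromatic number $A(G)$ is the minimum number of colors of an acyclic coloring of $G$. A vertex $v$ is a b-vertex if the colors on $v$ and its neighbors are all $k$ colors. A recoloring step applied to $c$ and a color $i$ having no b-vertex recolors every $v\in V_i$ with a color not appearing on $v$ or its neighbors, producing a $(k-1)$-coloring; if both colorings are acyclic it is an acyclic recoloring step. The acyclic b-chromatic number $A_b(G)$ is the maximum number of colors of an acyclic coloring of $G$ to which no acyclic recoloring step can be applied. -}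

module Defs where

open import Data.Nat using (ℕ; zero; suc; _+_; _≤_)
open import Data.Fin using (Fin; zero; suc; inject₁; fromℕ; punchIn)
open import Data.Bool using (Bool; true; false)
open import Data.Product using (Σ; ∃; ∃-syntax; _×_; _,_)
open import Data.Sum using (_⊎_)
open import Relation.Binary.PropositionalEquality using (_≡_; _≢_)
open import Relation.Nullary using (¬_)

record Graph : Set where
  field
    n      : ℕ
    adj    : Fin n → Fin n → Bool
    sym    : ∀ u v → adj u v ≡ adj v u
    irrefl : ∀ v → adj v v ≡ false

open Graph public

Vtx : Graph → Set
Vtx G = Fin (n G)

Adj : (G : Graph) → Vtx G → Vtx G → Set
Adj G u v = adj G u v ≡ true

-- A cycle in G all of whose vertices satisfy S: an injective sequence
-- f 0, f 1, ..., f (m+2) (length m+3 ≥ 3) of vertices with consecutive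
-- vertices adjacent and f (m+2) adjacent to f 0.
record Cycle (G : Graph) (S : Vtx G → Set) : Set where
  field
    m        : ℕ
    vert     : Fin (suc (suc (suc m))) → Vtx G
    injective : ∀ i j → vert i ≡ vert j → i ≡ j
    step     : ∀ (i : Fin (suc (suc m))) → Adj G (vert (inject₁ i)) (vert (suc i))
    close    : Adj G (vert (fromℕ (suc (suc m)))) (vert zero)
    inS      : ∀ i → S (vert i)

InducedForest : (G : Graph) → (Vtx G → Set) → Set
InducedForest G S = ¬ Cycle G S

IsColoring : (G : Graph) (k : ℕ) → (Vtx G → Fin k) → Set
IsColoring G k c =
  (∀ u v → Adj G u v → c u ≢ c v) × (∀ (j : Fin k) → ∃[ v ] c v ≡ j)

IsAcyclicColoring : (G : Graph) (k : ℕ) → (Vtx G → Fin k) → Set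
IsAcyclicColoring G k c =
  IsColoring G k c ×
  (∀ (i j : Fin k) → InducedForest G (λ v → (c v ≡ i) ⊎ (c v ≡ j)))

IsBVertex : (G : Graph) (k : ℕ) → (Vtx G → Fin k) → Vtx G → Set
IsBVertex G k c v = ∀ (j : Fin k) → (c v ≡ j) ⊎ (∃[ u ] (Adj G v u × c u ≡ j))

-- c' : V → Fin k (colors Fin (suc k) with color i removed, relabelled by
-- punchIn i) is the result of a recoloring step applied to c and color i:
-- vertices outside V_i keep their color, and each v ∈ V_i receives a color
-- not appearing on v or its neighbours.
IsRecoloringResult : (G : Graph) (k : ℕ) → (Vtx G → Fin (suc k)) → Fin (suc k)
                   → (Vtx G → Fin k) → Set
IsRecoloringResult G k c i c' =
  (∀ v → c v ≢ i → punchIn i (c' v) ≡ c v) ×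
  (∀ v → c v ≡ i → ∀ u → Adj G v u → c u ≢ punchIn i (c' v))

AcyclicRecoloringApplicable : (G : Graph) (k : ℕ) → (Vtx G → Fin k) → Set
AcyclicRecoloringApplicable G zero c = Σ (Fin zero) λ ()
AcyclicRecoloringApplicable G (suc k) c =
  Σ (Fin (suc k)) λ i →
    (∀ v → c v ≡ i → ¬ IsBVertex G (suc k) c v) ×
    Σ (Vtx G → Fin k) λ c' →
      IsRecoloringResult G k c i c' × IsAcyclicColoring G k c'

IsAcyclicChromaticNumber : Graph → ℕ → Set
IsAcyclicChromaticNumber G a =
  (Σ (Vtx G → Fin a) λ c → IsAcyclicColoring G a c) ×
  (∀ k (c : Vtx G → Fin k) → IsAcyclicColoring G k c → a ≤ k)

IsAcyclicBChromaticNumber : Graph → ℕ → Set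
IsAcyclicBChromaticNumber G b =
  (Σ (Vtx G → Fin b) λ c →
     IsAcyclicColoring G b c × ¬ AcyclicRecoloringApplicable G b c) ×
  (∀ k (c : Vtx G → Fin k) → IsAcyclicColoring G k c →
     ¬ AcyclicRecoloringApplicable G k c → k ≤ b)

{-# OPTIONS --safe #-}
module Submission where

-- Take m = q + 3 disjoint stars with m vertices each. The graph is a forest with an edge, so
-- every colouring is acyclic and A = 2. Colouring the vertices of each star with all m colours,
-- centre of star s coloured s, puts every colour on a centre, which is a b-vertex; hence
-- A_b ≥ m. With more than m colours some colour appears on no centre, so its class consists of
-- leaves, and each leaf can be recoloured with any colour other than its centre's; hence A_b = m.

open import Defs
open import Data.Nat using (ℕ; _+_; _≤_)
open import Data.Product using (Σ; ∃-syntax; _×_)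

open import Data.Bool using (Bool; true; false; not; _∧_; _xor_; if_then_else_)
open import Data.Bool.Properties using (∧-zeroʳ; xor-comm; xor-same; ¬-not; not-¬)
open import Function using (_∘_)
open import Data.Fin using (Fin; zero; suc; combine; quotient; remainder; punchIn; punchOut; _≟_)
open import Data.Fin.Properties
  using (remQuot-combine; combine-remQuot; punchIn-injective; punchInᵢ≢i; punchIn-punchOut; any?; ¬∀⟶∃¬; injective⇒≤)
open import Data.Nat using (zero; suc; _*_; z≤n; s≤s; _<_)
open import Data.Nat.Properties using (≤-trans; ≤-reflexive; +-comm; +-monoʳ-≤; n≤1+n; ≮⇒≥; <⇒≱)
open import Data.Product using (∃; _,_; proj₁; proj₂)
open import Data.Sum using (inj₁; inj₂)
open import Relation.Nullary using (¬_; Dec; yes; no; does; contradiction)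
open import Relation.Nullary.Decidable using (dec-true; dec-false)
open import Relation.Binary.PropositionalEquality
  using (_≡_; _≢_; refl; trans; cong; cong₂; ≢-sym; module ≡-Reasoning) renaming (sym to ≡-sym)

private variable
  G : Graph
  k l : ℕ

Adj-sym : (G : Graph) (u v : Vtx G) → Adj G u v → Adj G v u
Adj-sym G u v = trans (Graph.sym G v u)

does-≟-sym : (s t : Fin k) → does (s ≟ t) ≡ does (t ≟ s)
does-≟-sym s t with s ≟ t | t ≟ s
... | yes _ | yes _ = refl
... | no _ | no _ = refl
... | yes s≡t | no t≢s = contradiction (≡-sym s≡t) t≢s
... | no s≢t | yes t≡s = contradiction (≡-sym t≡s) s≢t

Forest : Graph → Set₁
Forest G = ∀ S → InducedForest G S

forest⇒acyclicColoring : {c : Vtx G → Fin k} → Forest G → IsColoring G k c → IsAcyclicColoring G k c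
forest⇒acyclicColoring forest isColoring = isColoring , λ _ _ → forest _

TwoPathsEndAtLeaves : Graph → Set
TwoPathsEndAtLeaves G = ∀ {a b c w} → Adj G a b → Adj G b c → a ≢ c → Adj G c w → w ≡ b

-- The first three vertices of a cycle form a path whose end has a second neighbour on the cycle.
twoPathsEndAtLeaves⇒forest : TwoPathsEndAtLeaves G → Forest G
twoPathsEndAtLeaves⇒forest leafy S record { m = zero ; injective = inj ; step = step ; close = close }
  with () ← inj zero (suc zero) (leafy (step zero) (step (suc zero)) (λ e → contradiction (inj _ _ e) λ ()) close)
twoPathsEndAtLeaves⇒forest leafy S record { m = suc _ ; injective = inj ; step = step }
  with () ← inj (suc (suc (suc zero))) (suc zero)
              (leafy (step zero) (step (suc zero)) (λ e → contradiction (inj _ _ e) λ ()) (step (suc (suc zero))))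

edge⇒2≤colours : ∀ {u v} {c : Vtx G → Fin k} → Adj G u v → IsColoring G k c → 2 ≤ k
edge⇒2≤colours {k = zero} {u} {c = c} _ _ with () ← c u
edge⇒2≤colours {k = suc zero} {u} {v} {c} uv (proper , _) = contradiction (fin1 (c u) (c v)) (proper u v uv)
  where
  fin1 : (x y : Fin 1) → x ≡ y
  fin1 zero zero = refl
edge⇒2≤colours {k = suc (suc _)} _ _ = s≤s (s≤s z≤n)

onto⇒≤ : (f : Fin l → Fin k) → (∀ i → ∃ λ s → f s ≡ i) → k ≤ l
onto⇒≤ f onto = injective⇒≤ {f = λ i → proj₁ (onto i)}
  λ {i} {j} e → trans (≡-sym (proj₂ (onto i))) (trans (cong f e) (proj₂ (onto j)))

missedValue : (f : Fin l → Fin k) → l < k → ∃ λ i → ∀ s → f s ≢ i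
missedValue {k = k} f l<k
  with i , noPreimage ← ¬∀⟶∃¬ k (λ i → ∃ λ s → f s ≡ i) (λ i → any? λ s → f s ≟ i) (<⇒≱ l<k ∘ onto⇒≤ f)
  = i , λ s fs≡i → noPreimage (s , fs≡i)

module _ {c : Vtx G → Fin (suc k)} {i : Fin (suc k)} {c′ : Vtx G → Fin k}
         (recoloured : IsRecoloringResult G k c i c′) where

  recoloring-isColoring : IsColoring G (suc k) c → IsColoring G k c′
  recoloring-isColoring (proper , onto) = proper′ , onto′
    where
    keep : ∀ v → c v ≢ i → punchIn i (c′ v) ≡ c v
    keep = proj₁ recoloured
    avoid : ∀ v → c v ≡ i → ∀ u → Adj G v u → c u ≢ punchIn i (c′ v)
    avoid = proj₂ recoloured

    proper′ : ∀ u v → Adj G u v → c′ u ≢ c′ v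
    proper′ u v uv c′u≡c′v with c u ≟ i | c v ≟ i
    ... | yes cu≡i | yes cv≡i = proper u v uv (trans cu≡i (≡-sym cv≡i))
    ... | yes cu≡i | no cv≢i = avoid u cu≡i v uv (trans (≡-sym (keep v cv≢i)) (cong (punchIn i) (≡-sym c′u≡c′v)))
    ... | no cu≢i | yes cv≡i = avoid v cv≡i u (Adj-sym G u v uv) (trans (≡-sym (keep u cu≢i)) (cong (punchIn i) c′u≡c′v))
    ... | no cu≢i | no cv≢i = proper u v uv (trans (≡-sym (keep u cu≢i)) (trans (cong (punchIn i) c′u≡c′v) (keep v cv≢i)))

    onto′ : ∀ j → ∃[ v ] c′ v ≡ j
    onto′ j with v , cv≡ ← onto (punchIn i j) =
      v , punchIn-injective i (c′ v) j (trans (keep v cv≢i) cv≡)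
      where
      cv≢i : c v ≢ i
      cv≢i cv≡i = punchInᵢ≢i i j (trans (≡-sym cv≡) cv≡i)

  recoloring-¬bVertex : ∀ v → c v ≡ i → ¬ IsBVertex G (suc k) c v
  recoloring-¬bVertex v cv≡i bVertex with bVertex (punchIn i (c′ v))
  ... | inj₁ cv≡ = punchInᵢ≢i i (c′ v) (trans (≡-sym cv≡) cv≡i)
  ... | inj₂ (u , vu , cu≡) = proj₂ recoloured v cv≡i u vu cu≡

bVertexInEveryClass⇒¬recoloringApplicable : {c : Vtx G → Fin k} →
  (∀ i → ∃[ v ] c v ≡ i × IsBVertex G k c v) → ¬ AcyclicRecoloringApplicable G k c
bVertexInEveryClass⇒¬recoloringApplicable {k = suc _} hasB (i , noB , _)
  with v , cv≡i , bVertex ← hasB i = noB v cv≡i bVertex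

∃-punchIn≢ : (i x : Fin (3 + k)) → ∃ λ (j : Fin (2 + k)) → punchIn i j ≢ x
∃-punchIn≢ i x with punchIn i zero ≟ x
... | no ne = zero , ne
... | yes e = suc zero , λ e′ → contradiction (punchIn-injective i zero (suc zero) (trans e (≡-sym e′))) λ ()

DegreeAtMostOne : (G : Graph) → Vtx G → Set
DegreeAtMostOne G v = ∃[ p ] ∀ u → Adj G v u → u ≡ p

module _ (c : Vtx G → Fin (3 + k)) (i : Fin (3 + k))
         (degree≤1 : ∀ v → c v ≡ i → DegreeAtMostOne G v) where

  private
    recolour : ∀ v → Dec (c v ≡ i) → Fin (2 + k)
    recolour v (yes cv≡i) = proj₁ (∃-punchIn≢ i (c (proj₁ (degree≤1 v cv≡i))))
    recolour v (no cv≢i) = punchOut (≢-sym cv≢i)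

    keep : ∀ v d → c v ≢ i → punchIn i (recolour v d) ≡ c v
    keep v (yes cv≡i) cv≢i = contradiction cv≡i cv≢i
    keep v (no cv≢i) _ = punchIn-punchOut (≢-sym cv≢i)

    avoid : ∀ v d → c v ≡ i → ∀ u → Adj G v u → c u ≢ punchIn i (recolour v d)
    avoid v (yes cv≡i) _ u vu cu≡ with p , onlyNeighbour ← degree≤1 v cv≡i =
      proj₂ (∃-punchIn≢ i (c p)) (trans (≡-sym cu≡) (cong c (onlyNeighbour u vu)))
    avoid v (no cv≢i) cv≡i = contradiction cv≡i cv≢i

  lowDegreeClass-recoloring : Σ (Vtx G → Fin (2 + k)) λ c′ → IsRecoloringResult G (2 + k) c i c′
  lowDegreeClass-recoloring =
    (λ v → recolour v (c v ≟ i)) , (λ v → keep v (c v ≟ i)) , (λ v → avoid v (c v ≟ i))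

  lowDegreeClass⇒recoloringApplicable :
    Forest G → IsColoring G (3 + k) c → AcyclicRecoloringApplicable G (3 + k) c
  lowDegreeClass⇒recoloringApplicable forest isColoring =
    i , recoloring-¬bVertex {G} recoloured , c′ , recoloured ,
    forest⇒acyclicColoring forest (recoloring-isColoring {G} recoloured isColoring)
    where
    c′ : Vtx G → Fin (2 + k)
    c′ = proj₁ lowDegreeClass-recoloring
    recoloured : IsRecoloringResult G (2 + k) c i c′
    recoloured = proj₂ lowDegreeClass-recoloring

module StarForest (q : ℕ) where

  m : ℕ
  m = 3 + q

  opaque
    vertex : Fin m → Fin m → Fin (m * m)
    vertex = combine

    star slot : Fin (m * m) → Fin m
    star = quotient {m} m
    slot = remainder {m} m

    star-vertex : ∀ (s t : Fin m) → star (vertex s t) ≡ s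
    star-vertex s t = cong proj₁ (remQuot-combine {m} {m} s t)

    slot-vertex : ∀ (s t : Fin m) → slot (vertex s t) ≡ t
    slot-vertex s t = cong proj₂ (remQuot-combine {m} {m} s t)

    vertex-star-slot : ∀ u → vertex (star u) (slot u) ≡ u
    vertex-star-slot u = combine-remQuot {m} m u

  centre : Fin m → Fin (m * m)
  centre s = vertex s s

  isCentre : Fin (m * m) → Bool
  isCentre u = does (slot u ≟ star u)

  isCentre⇒≡centre : ∀ u → isCentre u ≡ true → u ≡ centre (star u)
  isCentre⇒≡centre u isC with slot u ≟ star u
  ... | yes slot≡star = trans (≡-sym (vertex-star-slot u)) (cong (vertex (star u)) slot≡star)

  -- Vertex s t is slot t of star s; star s has its centre in slot s.
  graph : Graph
  graph = record
    { n = m * m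
    ; adj = λ u v → does (star u ≟ star v) ∧ (isCentre u xor isCentre v)
    ; sym = λ u v → cong₂ _∧_ (does-≟-sym (star u) (star v)) (xor-comm (isCentre u) (isCentre v))
    ; irrefl = λ v → trans (cong (does (star v ≟ star v) ∧_) (xor-same (isCentre v))) (∧-zeroʳ _)
    }

  Adj⇒sameStar×isCentre≡not : ∀ u v → Adj graph u v → star u ≡ star v × isCentre v ≡ not (isCentre u)
  Adj⇒sameStar×isCentre≡not u v uv with star u ≟ star v
  ... | yes star≡ = star≡ , ¬-not λ centre≡ → contradiction (trans (≡-sym uv) (xor-≡ centre≡)) λ ()
    where
    xor-≡ : isCentre v ≡ isCentre u → isCentre u xor isCentre v ≡ false
    xor-≡ centre≡ = trans (cong (isCentre u xor_) centre≡) (xor-same (isCentre u))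

  leafNeighbour≡centre : ∀ v u → isCentre v ≡ false → Adj graph v u → u ≡ centre (star v)
  leafNeighbour≡centre v u isLeaf vu with sameStar , u-kind ← Adj⇒sameStar×isCentre≡not v u vu =
    trans (isCentre⇒≡centre u (trans u-kind (cong not isLeaf))) (cong centre (≡-sym sameStar))

  middleOfTwoPath-isCentre : ∀ a b c → Adj graph a b → Adj graph b c → a ≢ c → isCentre b ≡ true
  middleOfTwoPath-isCentre a b c ab bc a≢c = ¬-not λ isLeaf →
    a≢c (trans (leafNeighbour≡centre b a isLeaf (Adj-sym graph a b ab)) (≡-sym (leafNeighbour≡centre b c isLeaf bc)))

  twoPathsEndAtLeaves : TwoPathsEndAtLeaves graph
  twoPathsEndAtLeaves {a} {b} {c} {w} ab bc a≢c cw = begin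
    w                ≡⟨ leafNeighbour≡centre c w (trans c-kind (cong not b-isCentre)) cw ⟩
    centre (star c)  ≡⟨ cong centre sameStar ⟨
    centre (star b)  ≡⟨ isCentre⇒≡centre b b-isCentre ⟨
    b                ∎
    where
    open ≡-Reasoning
    b-isCentre : isCentre b ≡ true
    b-isCentre = middleOfTwoPath-isCentre a b c ab bc a≢c
    sameStar : star b ≡ star c
    sameStar = proj₁ (Adj⇒sameStar×isCentre≡not b c bc)
    c-kind : isCentre c ≡ not (isCentre b)
    c-kind = proj₂ (Adj⇒sameStar×isCentre≡not b c bc)

  forest : Forest graph
  forest = twoPathsEndAtLeaves⇒forest twoPathsEndAtLeaves

  isCentre-vertex : ∀ s t → isCentre (vertex s t) ≡ does (t ≟ s)
  isCentre-vertex s t = cong₂ (λ x y → does (x ≟ y)) (slot-vertex s t) (star-vertex s t)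

  isCentre-centre : ∀ s → isCentre (centre s) ≡ true
  isCentre-centre s = trans (isCentre-vertex s s) (dec-true (s ≟ s) refl)

  isCentre-leaf : ∀ s t → t ≢ s → isCentre (vertex s t) ≡ false
  isCentre-leaf s t t≢s = trans (isCentre-vertex s t) (dec-false (t ≟ s) t≢s)

  centre-adj-leaf : ∀ s t → t ≢ s → Adj graph (centre s) (vertex s t)
  centre-adj-leaf s t t≢s = cong₂ _∧_ sameStar (cong₂ _xor_ (isCentre-centre s) (isCentre-leaf s t t≢s))
    where
    sameStar : does (star (centre s) ≟ star (vertex s t)) ≡ true
    sameStar = trans (cong₂ (λ x y → does (x ≟ y)) (star-vertex s s) (star-vertex s t)) (dec-true (s ≟ s) refl)

  centreOrLeaf : Fin (m * m) → Fin 2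
  centreOrLeaf u = if isCentre u then zero else suc zero

  centreOrLeaf-isAcyclicColoring : IsAcyclicColoring graph 2 centreOrLeaf
  centreOrLeaf-isAcyclicColoring = forest⇒acyclicColoring forest (proper , onto)
    where
    proper : ∀ u v → Adj graph u v → centreOrLeaf u ≢ centreOrLeaf v
    proper u v uv with isCentre u | isCentre v | proj₂ (Adj⇒sameStar×isCentre≡not u v uv)
    ... | true | false | _ = λ ()
    ... | false | true | _ = λ ()

    onto : ∀ j → ∃[ v ] centreOrLeaf v ≡ j
    onto zero = centre zero , cong (if_then zero else suc zero) (isCentre-centre zero)
    onto (suc zero) = vertex zero (suc zero) , cong (if_then zero else suc zero) (isCentre-leaf zero (suc zero) (λ ()))

  acyclicChromaticNumber≡2 : IsAcyclicChromaticNumber graph 2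
  acyclicChromaticNumber≡2 = (centreOrLeaf , centreOrLeaf-isAcyclicColoring) , λ k c acyclic →
    edge⇒2≤colours {graph} (centre-adj-leaf zero (suc zero) (λ ())) (proj₁ acyclic)

  slot-isAcyclicColoring : IsAcyclicColoring graph m slot
  slot-isAcyclicColoring = forest⇒acyclicColoring forest (proper , λ j → centre j , slot-vertex j j)
    where
    proper : ∀ u v → Adj graph u v → slot u ≢ slot v
    proper u v uv slot≡ with sameStar , v-kind ← Adj⇒sameStar×isCentre≡not u v uv =
      not-¬ (cong₂ (λ x y → does (x ≟ y)) (≡-sym slot≡) (≡-sym sameStar)) v-kind

  centre-isBVertex : ∀ s → IsBVertex graph m slot (centre s)
  centre-isBVertex s j with j ≟ s
  ... | yes j≡s = inj₁ (trans (slot-vertex s s) (≡-sym j≡s))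
  ... | no j≢s = inj₂ (vertex s j , centre-adj-leaf s j j≢s , slot-vertex s j)

  slot-¬recoloringApplicable : ¬ AcyclicRecoloringApplicable graph m slot
  slot-¬recoloringApplicable = bVertexInEveryClass⇒¬recoloringApplicable λ j →
    centre j , slot-vertex j j , centre-isBVertex j

  ¬recoloringApplicable⇒≤m : ∀ k (c : Fin (m * m) → Fin k) → IsAcyclicColoring graph k c →
                             ¬ AcyclicRecoloringApplicable graph k c → k ≤ m
  ¬recoloringApplicable⇒≤m zero _ _ _ = z≤n
  ¬recoloringApplicable⇒≤m (suc zero) _ _ _ = s≤s z≤n
  ¬recoloringApplicable⇒≤m (suc (suc zero)) _ _ _ = s≤s (s≤s z≤n)
  ¬recoloringApplicable⇒≤m (suc (suc (suc k))) c (isColoring , _) stuck = ≮⇒≥ λ m<k →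
    let i , centresAvoid-i = missedValue (c ∘ centre) m<k in
    stuck (lowDegreeClass⇒recoloringApplicable c i (leafClass i centresAvoid-i) forest isColoring)
    where
    leafClass : ∀ i → (∀ s → c (centre s) ≢ i) → ∀ v → c v ≡ i → DegreeAtMostOne graph v
    leafClass i centresAvoid-i v cv≡i = centre (star v) , λ u → leafNeighbour≡centre v u isLeaf
      where
      isLeaf : isCentre v ≡ false
      isLeaf = ¬-not λ isC → centresAvoid-i (star v) (trans (cong c (≡-sym (isCentre⇒≡centre v isC))) cv≡i)

  acyclicBChromaticNumber≡m : IsAcyclicBChromaticNumber graph m
  acyclicBChromaticNumber≡m = (slot , slot-isAcyclicColoring , slot-¬recoloringApplicable) , ¬recoloringApplicable⇒≤m

corollary5 : Σ (ℕ → Graph) λ G → Σ (ℕ → ℕ) λ a → Σ (ℕ → ℕ) λ b →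
    (∀ n → IsAcyclicChromaticNumber (G n) (a n) × IsAcyclicBChromaticNumber (G n) (b n)) ×
    (∀ M → ∃[ N ] ∀ n → N ≤ n → M + a n ≤ b n)
corollary5 =
  StarForest.graph , (λ _ → 2) , StarForest.m ,
  (λ q → StarForest.acyclicChromaticNumber≡2 q , StarForest.acyclicBChromaticNumber≡m q) ,
  λ M → M , λ q M≤q → ≤-trans (≤-reflexive (+-comm M 2)) (+-monoʳ-≤ 2 (≤-trans M≤q (n≤1+n q)))
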